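{- Let $G$ be a connected $(P_5,\text{chair})$-free graph and let $C=v_1v_2v_3v_4v_5$ be an induced $C_5$ in $G$ (indices modulo 5). For $1\le i\le 5$ define, with all sets taken in $V(G)\setminus V(C)$: $S^1_3(i)=\{v: N_C(v)=\{v_{i-1},v_i,v_{i+1}\}\}$ and $S_4(i)=\{v: N_C(v)=\{v_{i-2},v_{i-1},v_{i+1},v_{i+2}\}\}$. Then for every $1\le i\le 5$, every vertex $s\in S^1_3(i)\cup S_4(i+2)\cup S_4(i-2)$ and every two nonadjacent vertices $u,v\in S_4(i)$, the vertex $s$ is either adjacent to both $u$ and $v$ or nonadjacent to both.
   Context: Graphs are finite and simple. $P_5$ is the path on 5 vertices; a chair is a $P_4$ with an additional vertex adjacent to exactly one of the two middle vertices of the $P_4$. $G$ is $(P_5,\text{chair})$-free if it has no induced subgraph isomorphic to $P_5$ or to the chair. $N_C(v)=N(v)\cap V(C)$. -}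

module Defs where

open import Data.Nat using (ℕ; suc)
open import Data.Fin using (Fin; zero; suc; _≟_)
open import Data.Bool using (Bool; true; false; _∨_)
open import Data.List using (List; []; _∷_)
open import Data.Product using (Σ; _×_; ∃-syntax)
open import Relation.Nullary using (¬_)
open import Relation.Nullary.Decidable using (⌊_⌋)
open import Relation.Binary.PropositionalEquality using (_≡_; _≢_)
open import Function.Definitions using (Injective)

record Graph (n : ℕ) : Set where
  field
    adj    : Fin n → Fin n → Bool
    sym    : ∀ u v → adj u v ≡ adj v u
    irrefl : ∀ v → adj v v ≡ false
open Graph public

data Walk {n : ℕ} (G : Graph n) : Fin n → Fin n → Set where
  here : ∀ v → Walk G v v
  step : ∀ u w v → adj G u w ≡ true → Walk G w v → Walk G u v

Connected : {n : ℕ} → Graph n → Set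
Connected G = ∀ u v → Walk G u v

InducedCopy : {n k : ℕ} → (Fin k → Fin k → Bool) → Graph n → (Fin k → Fin n) → Set
InducedCopy {n} {k} H G f = Injective _≡_ _≡_ f × (∀ i j → adj G (f i) (f j) ≡ H i j)

HasInduced : {n k : ℕ} → (Fin k → Fin k → Bool) → Graph n → Set
HasInduced {n} {k} H G = ∃[ f ] InducedCopy H G f

eqb : {k : ℕ} → Fin k → Fin k → Bool
eqb i j = ⌊ i ≟ j ⌋

s5 : Fin 5 → Fin 5
s5 zero = suc zero
s5 (suc zero) = suc (suc zero)
s5 (suc (suc zero)) = suc (suc (suc zero))
s5 (suc (suc (suc zero))) = suc (suc (suc (suc zero)))
s5 (suc (suc (suc (suc zero)))) = zero

p5 : Fin 5 → Fin 5
p5 zero = suc (suc (suc (suc zero)))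
p5 (suc zero) = zero
p5 (suc (suc zero)) = suc zero
p5 (suc (suc (suc zero))) = suc (suc zero)
p5 (suc (suc (suc (suc zero)))) = suc (suc (suc zero))

P5 : Fin 5 → Fin 5 → Bool
P5 zero (suc zero) = true
P5 (suc zero) zero = true
P5 (suc zero) (suc (suc zero)) = true
P5 (suc (suc zero)) (suc zero) = true
P5 (suc (suc zero)) (suc (suc (suc zero))) = true
P5 (suc (suc (suc zero))) (suc (suc zero)) = true
P5 (suc (suc (suc zero))) (suc (suc (suc (suc zero)))) = true
P5 (suc (suc (suc (suc zero)))) (suc (suc (suc zero))) = true
P5 _ _ = false

Chair : Fin 5 → Fin 5 → Bool
Chair zero (suc zero) = true
Chair (suc zero) zero = true
Chair (suc zero) (suc (suc zero)) = true
Chair (suc (suc zero)) (suc zero) = true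
Chair (suc (suc zero)) (suc (suc (suc zero))) = true
Chair (suc (suc (suc zero))) (suc (suc zero)) = true
Chair (suc zero) (suc (suc (suc (suc zero)))) = true
Chair (suc (suc (suc (suc zero)))) (suc zero) = true
Chair _ _ = false

C5 : Fin 5 → Fin 5 → Bool
C5 i j = eqb j (s5 i) ∨ eqb j (p5 i)

-- Induced C5 given by c : Fin 5 → Fin n (c i = v_{i+1})
InducedC5 : {n : ℕ} → Graph n → (Fin 5 → Fin n) → Set
InducedC5 G c = InducedCopy C5 G c

OffC : {n : ℕ} → (Fin 5 → Fin n) → Fin n → Set
OffC c v = ∀ j → v ≢ c j

NCis : {n : ℕ} → Graph n → (Fin 5 → Fin n) → Fin n → (Fin 5 → Bool) → Set
NCis G c v T = ∀ j → adj G v (c j) ≡ T j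

S13 : {n : ℕ} → Graph n → (Fin 5 → Fin n) → Fin 5 → Fin n → Set
S13 G c i v = OffC c v × NCis G c v (λ j → eqb j (p5 i) ∨ eqb j i ∨ eqb j (s5 i))

S4 : {n : ℕ} → Graph n → (Fin 5 → Fin n) → Fin 5 → Fin n → Set
S4 G c i v = OffC c v × NCis G c v
  (λ j → eqb j (p5 (p5 i)) ∨ eqb j (p5 i) ∨ eqb j (s5 i) ∨ eqb j (s5 (s5 i)))

-- If s saw exactly one of u and v, say u, then with w = v_i (a neighbour of s
-- missed by u and v) and x = v_{i±2} (a common neighbour of u and v missed by
-- s and v_i) the path v – x – u – s – w would be an induced P₅.
module Submission where

open import Defs
open import Data.Nat using (ℕ)
open import Data.Fin using (Fin; zero; suc)
open import Data.Fin.Properties using (all?)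
import Data.Fin.Properties as Fin
import Data.Bool.Properties as Bool
open import Data.Bool using (Bool; true; false; _∨_)
open import Data.Vec using (_∷_; []; lookup)
open import Data.Sum using (_⊎_; inj₁; inj₂)
open import Data.Product using (_×_; _,_; proj₁; proj₂; ∃-syntax)
open import Function.Definitions using (Injective)
open import Relation.Nullary using (¬_)
open import Relation.Nullary.Decidable using (toWitness; _→-dec_)
open import Relation.Binary.PropositionalEquality
  using (_≡_; refl; trans; cong) renaming (sym to ≡-sym)

module _ {n : ℕ} (G : Graph n) where

  adj-sym : ∀ {x y} {b : Bool} → adj G x y ≡ b → adj G y x ≡ b
  adj-sym {x} {y} p = trans (Graph.sym G y x) p

  -- Equal images have equal rows in G, hence equal rows in H.
  pattern-preserving⇒injective : {k : ℕ} {H : Fin k → Fin k → Bool} {f : Fin k → Fin n} →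
    (∀ x y → (∀ z → H x z ≡ H y z) → x ≡ y) →
    (∀ i j → adj G (f i) (f j) ≡ H i j) → Injective _≡_ _≡_ f
  pattern-preserving⇒injective {f = f} rows-distinct preserves {x} {y} fx≡fy =
    rows-distinct x y λ z →
      trans (≡-sym (preserves x z)) (trans (cong (λ w → adj G w (f z)) fx≡fy) (preserves y z))

P5-rows-distinct : ∀ x y → (∀ z → P5 x z ≡ P5 y z) → x ≡ y
P5-rows-distinct = toWitness {a? = all? λ x → all? λ y →
  all? (λ z → P5 x z Bool.≟ P5 y z) →-dec x Fin.≟ y} _

module _ {n : ℕ} (G : Graph n) {a b c d e : Fin n}
  (ab : adj G a b ≡ true) (bc : adj G b c ≡ true) (cd : adj G c d ≡ true) (de : adj G d e ≡ true)
  (ac : adj G a c ≡ false) (ad : adj G a d ≡ false) (ae : adj G a e ≡ false)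
  (bd : adj G b d ≡ false) (be : adj G b e ≡ false) (ce : adj G c e ≡ false) where

  private
    path : Fin 5 → Fin n
    path = lookup (a ∷ b ∷ c ∷ d ∷ e ∷ [])

    path-preserves-P5 : ∀ i j → adj G (path i) (path j) ≡ P5 i j
    path-preserves-P5 zero zero = irrefl G a
    path-preserves-P5 zero (suc zero) = ab
    path-preserves-P5 zero (suc (suc zero)) = ac
    path-preserves-P5 zero (suc (suc (suc zero))) = ad
    path-preserves-P5 zero (suc (suc (suc (suc zero)))) = ae
    path-preserves-P5 (suc zero) zero = adj-sym G ab
    path-preserves-P5 (suc zero) (suc zero) = irrefl G b
    path-preserves-P5 (suc zero) (suc (suc zero)) = bc
    path-preserves-P5 (suc zero) (suc (suc (suc zero))) = bd
    path-preserves-P5 (suc zero) (suc (suc (suc (suc zero)))) = be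
    path-preserves-P5 (suc (suc zero)) zero = adj-sym G ac
    path-preserves-P5 (suc (suc zero)) (suc zero) = adj-sym G bc
    path-preserves-P5 (suc (suc zero)) (suc (suc zero)) = irrefl G c
    path-preserves-P5 (suc (suc zero)) (suc (suc (suc zero))) = cd
    path-preserves-P5 (suc (suc zero)) (suc (suc (suc (suc zero)))) = ce
    path-preserves-P5 (suc (suc (suc zero))) zero = adj-sym G ad
    path-preserves-P5 (suc (suc (suc zero))) (suc zero) = adj-sym G bd
    path-preserves-P5 (suc (suc (suc zero))) (suc (suc zero)) = adj-sym G cd
    path-preserves-P5 (suc (suc (suc zero))) (suc (suc (suc zero))) = irrefl G d
    path-preserves-P5 (suc (suc (suc zero))) (suc (suc (suc (suc zero)))) = de
    path-preserves-P5 (suc (suc (suc (suc zero)))) zero = adj-sym G ae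
    path-preserves-P5 (suc (suc (suc (suc zero)))) (suc zero) = adj-sym G be
    path-preserves-P5 (suc (suc (suc (suc zero)))) (suc (suc zero)) = adj-sym G ce
    path-preserves-P5 (suc (suc (suc (suc zero)))) (suc (suc (suc zero))) = adj-sym G de
    path-preserves-P5 (suc (suc (suc (suc zero)))) (suc (suc (suc (suc zero)))) = irrefl G e

  induced-P5 : HasInduced P5 G
  induced-P5 = path , pattern-preserving⇒injective G P5-rows-distinct path-preserves-P5 , path-preserves-P5

module _ {n : ℕ} (G : Graph n) (no-P5 : ¬ HasInduced P5 G) {s u v w x : Fin n}
  (wx : adj G w x ≡ false) (sw : adj G s w ≡ true) (sx : adj G s x ≡ false)
  (ux : adj G u x ≡ true) (vx : adj G v x ≡ true)
  (uw : adj G u w ≡ false) (vw : adj G v w ≡ false) (uv : adj G u v ≡ false) where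

  private
    no-split : ∀ {p q} → adj G p x ≡ true → adj G q x ≡ true → adj G p w ≡ false → adj G q w ≡ false →
      adj G p q ≡ false → adj G s p ≡ true → adj G s q ≡ false → {A : Set} → A
    no-split px qx pw qw pq sp sq with () ← no-P5
      (induced-P5 G qx (adj-sym G px) (adj-sym G sp) sw
        (adj-sym G pq) (adj-sym G sq) qw (adj-sym G sx) (adj-sym G wx) pw)

  P5-free⇒agrees : adj G s u ≡ adj G s v
  P5-free⇒agrees with adj G s u in su | adj G s v in sv
  ... | true  | true  = refl
  ... | false | false = refl
  ... | true  | false = no-split ux vx uw vw uv su sv
  ... | false | true  = no-split vx ux vw uw (adj-sym G uv) sv su

S13-pattern S4-pattern : Fin 5 → Fin 5 → Bool
S13-pattern i j = eqb j (p5 i) ∨ eqb j i ∨ eqb j (s5 i)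
S4-pattern i j = eqb j (p5 (p5 i)) ∨ eqb j (p5 i) ∨ eqb j (s5 i) ∨ eqb j (s5 (s5 i))

S4-pattern-centre : ∀ i → S4-pattern i i ≡ false
S4-pattern-centre zero = refl
S4-pattern-centre (suc zero) = refl
S4-pattern-centre (suc (suc zero)) = refl
S4-pattern-centre (suc (suc (suc zero))) = refl
S4-pattern-centre (suc (suc (suc (suc zero)))) = refl

S4-pattern-opposite : ∀ i → S4-pattern i (s5 (s5 i)) ≡ true × S4-pattern i (p5 (p5 i)) ≡ true
S4-pattern-opposite zero = refl , refl
S4-pattern-opposite (suc zero) = refl , refl
S4-pattern-opposite (suc (suc zero)) = refl , refl
S4-pattern-opposite (suc (suc (suc zero))) = refl , refl
S4-pattern-opposite (suc (suc (suc (suc zero)))) = refl , refl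

S4-pattern-shifted : ∀ i → S4-pattern (s5 (s5 i)) i ≡ true × S4-pattern (p5 (p5 i)) i ≡ true
S4-pattern-shifted zero = refl , refl
S4-pattern-shifted (suc zero) = refl , refl
S4-pattern-shifted (suc (suc zero)) = refl , refl
S4-pattern-shifted (suc (suc (suc zero))) = refl , refl
S4-pattern-shifted (suc (suc (suc (suc zero)))) = refl , refl

S13-pattern-shape : ∀ i → S13-pattern i i ≡ true × S13-pattern i (s5 (s5 i)) ≡ false
S13-pattern-shape zero = refl , refl
S13-pattern-shape (suc zero) = refl , refl
S13-pattern-shape (suc (suc zero)) = refl , refl
S13-pattern-shape (suc (suc (suc zero))) = refl , refl
S13-pattern-shape (suc (suc (suc (suc zero)))) = refl , refl

C5-opposite : ∀ i → C5 (s5 (s5 i)) i ≡ false × C5 (p5 (p5 i)) i ≡ false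
C5-opposite zero = refl , refl
C5-opposite (suc zero) = refl , refl
C5-opposite (suc (suc zero)) = refl , refl
C5-opposite (suc (suc (suc zero))) = refl , refl
C5-opposite (suc (suc (suc (suc zero)))) = refl , refl

Opposite : Fin 5 → Fin 5 → Set
Opposite i t = t ≡ s5 (s5 i) ⊎ t ≡ p5 (p5 i)

opposite-shape : ∀ {i t} → Opposite i t → C5 t i ≡ false × S4-pattern i t ≡ true
opposite-shape {i} (inj₁ refl) = proj₁ (C5-opposite i) , proj₁ (S4-pattern-opposite i)
opposite-shape {i} (inj₂ refl) = proj₂ (C5-opposite i) , proj₂ (S4-pattern-opposite i)

module _ {n : ℕ} (G : Graph n) (c : Fin 5 → Fin n) {i : Fin 5} where

  sees-centre-misses-opposite : ∀ {s} → S13 G c i s ⊎ (S4 G c (s5 (s5 i)) s ⊎ S4 G c (p5 (p5 i)) s) →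
    ∃[ t ] Opposite i t × adj G s (c i) ≡ true × adj G s (c t) ≡ false
  sees-centre-misses-opposite (inj₁ (_ , N)) =
    s5 (s5 i) , inj₁ refl , trans (N i) (proj₁ (S13-pattern-shape i)) , trans (N _) (proj₂ (S13-pattern-shape i))
  sees-centre-misses-opposite (inj₂ (inj₁ (_ , N))) =
    s5 (s5 i) , inj₁ refl , trans (N i) (proj₁ (S4-pattern-shifted i)) , trans (N _) (S4-pattern-centre (s5 (s5 i)))
  sees-centre-misses-opposite (inj₂ (inj₂ (_ , N))) =
    p5 (p5 i) , inj₂ refl , trans (N i) (proj₂ (S4-pattern-shifted i)) , trans (N _) (S4-pattern-centre (p5 (p5 i)))

  S4-nonadjacent-pair-agrees : ¬ HasInduced P5 G → InducedC5 G c → ∀ {s u v t} →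
    S4 G c i u → S4 G c i v → adj G u v ≡ false →
    Opposite i t → adj G s (c i) ≡ true → adj G s (c t) ≡ false → adj G s u ≡ adj G s v
  S4-nonadjacent-pair-agrees no-P5 (_ , C) {t = t} (_ , Nu) (_ , Nv) uv t-opp si st
    with ti , it ← opposite-shape t-opp =
    P5-free⇒agrees G no-P5 (adj-sym G (trans (C t i) ti)) si st
      (trans (Nu t) it) (trans (Nv t) it)
      (trans (Nu i) (S4-pattern-centre i)) (trans (Nv i) (S4-pattern-centre i)) uv

claim8 : {n : ℕ} (G : Graph n) → Connected G → ¬ HasInduced P5 G → ¬ HasInduced Chair G →
         (c : Fin 5 → Fin n) → InducedC5 G c →
         (i : Fin 5) (s u v : Fin n) →
         (S13 G c i s ⊎ (S4 G c (s5 (s5 i)) s ⊎ S4 G c (p5 (p5 i)) s)) →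
         S4 G c i u → S4 G c i v → adj G u v ≡ false →
         adj G s u ≡ adj G s v
claim8 G _ no-P5 _ c isC5 i s u v s∈ u∈ v∈ uv
  with t , t-opp , si , st ← sees-centre-misses-opposite G c s∈ =
  S4-nonadjacent-pair-agrees G c no-P5 isC5 u∈ v∈ uv t-opp si st
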